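{- Let $\mathcal M=(G,\mathit{In},\mathit{Out},\mathit{Leak})$ be a leak-interlacing directed-cycle model with $|\mathit{In}|\ge1$, $|\mathit{Out}|\ge1$ and $|\mathit{Leak}|\ge2$. If $\mathcal M$ is not in the exceptional family, then there exist subsets $\mathit{In}'\subseteq\mathit{In}$ and $\mathit{Out}'\subseteq\mathit{Out}$ with $|\mathit{In}'|\ge1$, $|\mathit{Out}'|\ge1$ and $\mathit{In}'\cap\mathit{Out}'=\emptyset$ such that the model $\mathcal M'=(G,\mathit{In}',\mathit{Out}',\mathit{Leak})$ is minimally leak-interlacing.
   Context: A directed-cycle model $\mathcal M=(G,\mathit{In},\mathit{Out},\mathit{Leak})$ has $n\ge3$ compartments $V=\{1,\dots,n\}$, edges $E=\{1\to2,\dots,(n-1)\to n,n\to1\}$, and subsets $\mathit{In},\mathit{Out},\mathit{Leak}\subseteq V$ (input, output, leak compartments); indices are taken mod $n$. It is exceptional if for some $1\le i\le n$: $\mathit{In}=\{i\}$, $\mathit{Out}=\{i-1\}$, $|\mathit{Leak}|=2$ and $i-1\in\mathit{Leak}$. It is in the exceptional family if it is obtained from some exceptional model (same graph and leaks) by adding at least one input and/or at least one output. It is leak-interlacing if it is not exceptional and either $|\mathit{Leak}|\le1$, or $|\mathit{Leak}|\ge2$ with $\mathit{Leak}=\{\ell_1<\dots<\ell_z\}$ and, for every $\alpha\in\{1,\dots,z\}$, $S_\alpha:=\{\ell_\alpha+1,\ell_\alpha+2,\dots,\ell_{\alpha+1}\}$ satisfies $S_\alpha\cap(\mathit{In}\cup\mathit{Out})\ne\emptyset$,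 where $\ell_{z+1}:=\ell_1$ and $\ell_z+1,\dots,\ell_1$ are taken cyclically mod $n$. A model with $|\mathit{Leak}|\ge2$ is minimally leak-interlacing if it is leak-interlacing and, for every $\alpha\in\{1,\dots,z\}$, exactly one of the following holds: (a) $|S_\alpha\cap\mathit{In}|=1$ and $|S_\alpha\cap\mathit{Out}|=0$; (b) $|S_\alpha\cap\mathit{In}|=0$ and $|S_\alpha\cap\mathit{Out}|=1$. -}

module Defs where

open import Data.Nat using (ℕ; zero; suc; _≤_; _∸_)
open import Data.Nat.DivMod using (_mod_)
open import Data.Fin using (Fin; toℕ)
open import Data.Fin.Subset using (Subset; ⁅_⁆; _∪_; _∩_; ⊥; ∣_∣; _∈_; _⊆_; Nonempty; Empty)
open import Data.Fin.Subset.Properties using (_∈?_)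
open import Data.Product using (Σ; _×_; ∃)
open import Data.Sum using (_⊎_)
open import Relation.Nullary using (¬_; yes; no)
open import Relation.Binary.PropositionalEquality using (_≡_; _≢_)

-- Compartments 1,…,n are represented by Fin n = {0,…,n-1} (compartment k ↦ k-1).
-- The graph is the fixed directed cycle 1→2→…→n→1, so a model is determined by n
-- together with the three subsets In, Out, Leak.

record Model (n : ℕ) : Set where
  constructor model
  field
    In Out Leak : Subset n
open Model public

csuc : ∀ {n} → Fin n → Fin n
csuc {suc m} i = (suc (toℕ i)) mod (suc m)

cpred : ∀ {n} → Fin n → Fin n
cpred {suc m} i = (toℕ i Data.Nat.+ m) mod (suc m)

seg : ∀ {n} → Subset n → Fin n → ℕ → Subset n
seg L v zero = ⊥
seg L v (suc f) with v ∈? L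
... | yes _ = ⁅ v ⁆
... | no  _ = ⁅ v ⁆ ∪ seg L (csuc v) f

-- S ℓ = {ℓ+1, ℓ+2, …, ℓ'} where ℓ' is the next leak after ℓ along the cycle
-- (cyclically); for ℓ = ℓ_α this is S_α = {ℓ_α+1,…,ℓ_{α+1}}.
S : ∀ {n} → Model n → Fin n → Subset n
S {n} M ℓ = seg (Leak M) (csuc ℓ) n

Exceptional : ∀ {n} → Model n → Set
Exceptional M = ∃ λ i →
  (In M ≡ ⁅ i ⁆) × (Out M ≡ ⁅ cpred i ⁆) × (∣ Leak M ∣ ≡ 2) × (cpred i ∈ Leak M)

InExceptionalFamily : ∀ {n} → Model n → Set
InExceptionalFamily M = ∃ λ In₀ → ∃ λ Out₀ →
  Exceptional (model In₀ Out₀ (Leak M)) ×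
  (In₀ ⊆ In M) × (Out₀ ⊆ Out M) × ((In₀ ≢ In M) ⊎ (Out₀ ≢ Out M))

LeakInterlacing : ∀ {n} → Model n → Set
LeakInterlacing M = ¬ Exceptional M ×
  ((∣ Leak M ∣ ≤ 1) ⊎
   ((2 ≤ ∣ Leak M ∣) ×
    (∀ ℓ → ℓ ∈ Leak M → Nonempty (S M ℓ ∩ (In M ∪ Out M)))))

-- (a) and (b) are mutually exclusive, so "exactly one" is a disjoint sum
MinimallyLeakInterlacing : ∀ {n} → Model n → Set
MinimallyLeakInterlacing M = (2 ≤ ∣ Leak M ∣) × LeakInterlacing M ×
  (∀ ℓ → ℓ ∈ Leak M →
     ((∣ S M ℓ ∩ In M ∣ ≡ 1) × (∣ S M ℓ ∩ Out M ∣ ≡ 0)) ⊎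
     ((∣ S M ℓ ∩ In M ∣ ≡ 0) × (∣ S M ℓ ∩ Out M ∣ ≡ 1)))

{-# OPTIONS --safe #-}
-- For the leaks ℓ, the segments S ℓ = {ℓ+1, …, next leak} partition the cycle: a walk from ℓ+1
-- that stops at the first leak ends within one turn, walks from two different leaks cannot meet
-- (the longer one would have passed the leak the other starts from), and every vertex is reached by
-- one of them. Pick in each segment one vertex of In ∪ Out and keep it as an input or as an output
-- accordingly: then every segment carries exactly one input or exactly one output. Both kinds occur:
-- if a given input and a given output lie in different segments pick them, otherwise the segment of
-- a second leak supplies a vertex of the missing kind. The chosen submodel has the same leaks, so if
-- it were exceptional, M would be exceptional (nothing dropped) or in the exceptional family.
module Submission where

open import Defs
open import Data.Bool using (Bool; true; false; not)
open import Data.Bool.Properties using (not-¬) renaming (_≟_ to _≟ᵇ_)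
open import Data.Nat using (ℕ; zero; suc; _+_; _∸_; _≤_; _<_; z≤n; s≤s; _%_; NonZero)
open import Data.Nat.Properties
  using (+-identityʳ; +-suc; +-assoc; +-comm; m≤n+m; m+[n∸m]≡n; m≤n⇒∃[o]m+o≡n; m<1+n⇒m<n∨m≡n;
         <-cmp; <⇒≤; <⇒≱; ≰⇒>; m<n⇒n≢0; ≤-trans; _≤?_)
open import Data.Nat.DivMod using (%-distribˡ-+; m%n%n≡m%n; [m+n]%n≡m%n; m<n⇒m%n≡m)
open import Data.Nat.GeneralisedArithmetic using (fold; fold-+)
open import Data.Fin using (Fin; toℕ)
open import Data.Fin.Properties using (toℕ-fromℕ<; toℕ-injective; toℕ<n; toℕ≤pred[n]; any?; _≟_)
open import Data.Fin.Subset using (Subset; _⊆_; _∩_; _∪_; ∣_∣; Empty; Nonempty; _∈_; _∉_; ⁅_⁆)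
open import Data.Fin.Subset.Properties
  using (_∈?_; nonempty?; Empty-unique; ∣⊥∣≡0; ∉⊥; x∈⁅x⁆; x∈⁅y⁆⇒x≡y; ∣⁅x⁆∣≡1; ⊆-antisym;
         p⊆q⇒∣p∣≤∣q∣; x∈p⇒∣p-x∣<∣p∣; x∈p∩q⁺; x∈p∩q⁻; x∈p∪q⁺; x∈p∪q⁻; p⊆p∪q; q⊆p∪q)
open import Data.Product using (_×_; ∃; ∃₂; _,_; proj₁; proj₂; map₂)
import Data.Product.Properties as Product
open import Data.Sum using (_⊎_; inj₁; inj₂)
open import Data.Vec using (tabulate)
open import Data.Vec.Properties using (lookup∘tabulate; []=⇒lookup; lookup⇒[]=)
import Data.Vec.Properties as Vec
open import Data.Vec.Functional using (Vector; updateAt)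
open import Data.Vec.Functional.Properties using (updateAt-updates; updateAt-minimal)
open import Function using (_∘_; const)
open import Relation.Nullary using (¬_; Dec; yes; no; does; contradiction; ¬?)
open import Relation.Nullary.Decidable using (dec-true; _×-dec_)
open import Relation.Binary.Definitions using (tri<; tri≈; tri>)
open import Relation.Binary.PropositionalEquality
  using (_≡_; _≢_; refl; sym; trans; cong; subst; module ≡-Reasoning)

[1+m%n]%n≡[1+m]%n : ∀ m n .{{_ : NonZero n}} → suc (m % n) % n ≡ suc m % n
[1+m%n]%n≡[1+m]%n m n = begin
  (1 + m % n) % n          ≡⟨ %-distribˡ-+ 1 (m % n) n ⟩
  (1 % n + m % n % n) % n  ≡⟨ cong (λ r → (1 % n + r) % n) (m%n%n≡m%n m n) ⟩
  (1 % n + m % n) % n      ≡⟨ %-distribˡ-+ 1 m n ⟨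
  (1 + m) % n              ∎
  where open ≡-Reasoning

module _ {m : ℕ} where

  infixl 6 _⊕_
  _⊕_ : Fin (suc m) → ℕ → Fin (suc m)
  x ⊕ k = fold x csuc k

  toℕ-⊕ : ∀ x k → toℕ (x ⊕ k) ≡ (toℕ x + k) % suc m
  toℕ-⊕ x zero = sym (trans (cong (_% suc m) (+-identityʳ (toℕ x))) (m<n⇒m%n≡m (toℕ<n x)))
  toℕ-⊕ x (suc k) = begin
    toℕ (csuc (x ⊕ k))                 ≡⟨ toℕ-fromℕ< _ ⟩
    suc (toℕ (x ⊕ k)) % suc m          ≡⟨ cong (λ r → suc r % suc m) (toℕ-⊕ x k) ⟩
    suc ((toℕ x + k) % suc m) % suc m  ≡⟨ [1+m%n]%n≡[1+m]%n (toℕ x + k) (suc m) ⟩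
    suc (toℕ x + k) % suc m            ≡⟨ cong (_% suc m) (+-suc (toℕ x) k) ⟨
    (toℕ x + suc k) % suc m            ∎
    where open ≡-Reasoning

  ⊕-period : ∀ x → x ⊕ suc m ≡ x
  ⊕-period x = toℕ-injective (begin
    toℕ (x ⊕ suc m)          ≡⟨ toℕ-⊕ x (suc m) ⟩
    (toℕ x + suc m) % suc m  ≡⟨ [m+n]%n≡m%n (toℕ x) (suc m) ⟩
    toℕ x % suc m            ≡⟨ m<n⇒m%n≡m (toℕ<n x) ⟩
    toℕ x                    ∎)
    where open ≡-Reasoning

  csuc-⊕ : ∀ x k → csuc x ⊕ k ≡ x ⊕ suc k
  csuc-⊕ x zero = refl
  csuc-⊕ x (suc k) = cong csuc (csuc-⊕ x k)

  csuc-⊕-pred : ∀ x → csuc x ⊕ m ≡ x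
  csuc-⊕-pred x = trans (csuc-⊕ x m) (⊕-period x)

  csuc-injective : ∀ {x y} → csuc x ≡ csuc y → x ≡ y
  csuc-injective {x} {y} eq = begin
    x           ≡⟨ csuc-⊕-pred x ⟨
    csuc x ⊕ m  ≡⟨ cong (_⊕ m) eq ⟩
    csuc y ⊕ m  ≡⟨ csuc-⊕-pred y ⟩
    y           ∎
    where open ≡-Reasoning

  ⊕-cancelʳ : ∀ k {x y} → x ⊕ k ≡ y ⊕ k → x ≡ y
  ⊕-cancelʳ zero eq = eq
  ⊕-cancelʳ (suc k) eq = ⊕-cancelʳ k (csuc-injective eq)

  ⊕-<-offset : ∀ {j k x y} → j < k → x ⊕ j ≡ y ⊕ k → ∃ λ o → o < k × x ≡ y ⊕ suc o
  ⊕-<-offset {j} {x = x} {y} j<k eq with m≤n⇒∃[o]m+o≡n j<k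
  ... | o , refl = o , s≤s (m≤n+m o j) , ⊕-cancelʳ j (begin
    x ⊕ j                ≡⟨ eq ⟩
    y ⊕ (suc j + o)      ≡⟨ fold-+ y csuc (suc j) ⟩
    (y ⊕ o) ⊕ suc j      ≡⟨ csuc-⊕ (y ⊕ o) j ⟨
    (y ⊕ suc o) ⊕ j      ∎)
    where open ≡-Reasoning

  ⊕-surjective : ∀ x v → ∃ λ k → x ⊕ suc k ≡ v
  ⊕-surjective x v = k , toℕ-injective (begin
    toℕ (x ⊕ suc k)          ≡⟨ toℕ-⊕ x (suc k) ⟩
    (toℕ x + suc k) % suc m  ≡⟨ cong (_% suc m) x+1+k≡v+n ⟩
    (toℕ v + suc m) % suc m  ≡⟨ [m+n]%n≡m%n (toℕ v) (suc m) ⟩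
    toℕ v % suc m            ≡⟨ m<n⇒m%n≡m (toℕ<n v) ⟩
    toℕ v                    ∎)
    where
    open ≡-Reasoning
    k = m ∸ toℕ x + toℕ v
    x+1+k≡v+n : toℕ x + suc k ≡ toℕ v + suc m
    x+1+k≡v+n = begin
      toℕ x + suc k                      ≡⟨ +-suc (toℕ x) k ⟩
      suc (toℕ x + (m ∸ toℕ x + toℕ v))  ≡⟨ cong suc (+-assoc (toℕ x) (m ∸ toℕ x) (toℕ v)) ⟨
      suc (toℕ x + (m ∸ toℕ x) + toℕ v)  ≡⟨ cong (λ r → suc (r + toℕ v)) (m+[n∸m]≡n x≤m) ⟩
      suc m + toℕ v                      ≡⟨ +-comm (suc m) (toℕ v) ⟩
      toℕ v + suc m                      ∎
      where x≤m = toℕ≤pred[n] x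

module _ {m : ℕ} (L : Subset (suc m)) where

  LeakFree : Fin (suc m) → ℕ → Set
  LeakFree v j = ∀ {i} → i < j → v ⊕ i ∉ L

  LeakFree-cons : ∀ {v j} → v ∉ L → LeakFree (csuc v) j → LeakFree v (suc j)
  LeakFree-cons v∉L free {zero} _ = v∉L
  LeakFree-cons {v} v∉L free {suc i} (s≤s i<j) = free i<j ∘ subst (_∈ L) (sym (csuc-⊕ v i))

  LeakFree-snoc : ∀ {v j} → LeakFree v j → v ⊕ j ∉ L → LeakFree v (suc j)
  LeakFree-snoc free v⊕j∉L i<1+j with m<1+n⇒m<n∨m≡n i<1+j
  ... | inj₁ i<j = free i<j
  ... | inj₂ refl = v⊕j∉L

  LeakFree-length : ∀ {ℓ j} → ℓ ∈ L → LeakFree (csuc ℓ) j → j ≤ m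
  LeakFree-length {ℓ} {j} ℓ∈L free with j ≤? m
  ... | yes j≤m = j≤m
  ... | no j≰m = contradiction (subst (_∈ L) (sym (csuc-⊕-pred ℓ)) ℓ∈L) (free (≰⇒> j≰m))

  ∈seg⁻ : ∀ {v x} f → x ∈ seg L v f → ∃ λ j → j < f × v ⊕ j ≡ x × LeakFree v j
  ∈seg⁻ zero x∈ = contradiction x∈ ∉⊥
  ∈seg⁻ {v} (suc f) x∈ with v ∈? L
  ... | yes _ = 0 , s≤s z≤n , sym (x∈⁅y⁆⇒x≡y v x∈) , λ ()
  ... | no v∉L with x∈p∪q⁻ ⁅ v ⁆ (seg L (csuc v) f) x∈
  ...   | inj₁ x∈⁅v⁆ = 0 , s≤s z≤n , sym (x∈⁅y⁆⇒x≡y v x∈⁅v⁆) , λ ()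
  ...   | inj₂ x∈seg with ∈seg⁻ f x∈seg
  ...     | j , j<f , eq , free =
    suc j , s≤s j<f , trans (sym (csuc-⊕ v j)) eq , LeakFree-cons v∉L free

  ∈seg⁺ : ∀ {v j} f → j < f → LeakFree v j → v ⊕ j ∈ seg L v f
  ∈seg⁺ {v} {zero} (suc f) _ _ with v ∈? L
  ... | yes _ = x∈⁅x⁆ v
  ... | no _ = x∈p∪q⁺ (inj₁ (x∈⁅x⁆ v))
  ∈seg⁺ {v} {suc j} (suc f) (s≤s j<f) free with v ∈? L
  ... | yes v∈L = contradiction v∈L (free (s≤s z≤n))
  ... | no _ = x∈p∪q⁺ (inj₂ (subst (_∈ seg L (csuc v) f) (csuc-⊕ v j) (∈seg⁺ f j<f free′)))
    where
    free′ : LeakFree (csuc v) j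
    free′ {i} i<j = free (s≤s i<j) ∘ subst (_∈ L) (csuc-⊕ v i)

  LeakFree⇒∉ : ∀ {ℓ y j k} → j < k → csuc ℓ ⊕ j ≡ y ⊕ k → LeakFree y k → ℓ ∉ L
  LeakFree⇒∉ j<k eq free ℓ∈L with ⊕-<-offset j<k eq
  ... | o , o<k , csucℓ≡ = free o<k (subst (_∈ L) (csuc-injective csucℓ≡) ℓ∈L)

  seg-disjoint : ∀ {ℓ ℓ′ x f f′} → ℓ ∈ L → ℓ′ ∈ L →
                 x ∈ seg L (csuc ℓ) f → x ∈ seg L (csuc ℓ′) f′ → ℓ ≡ ℓ′
  seg-disjoint {f = f} {f′} ℓ∈L ℓ′∈L x∈ x∈′ with ∈seg⁻ f x∈ | ∈seg⁻ f′ x∈′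
  ... | j , _ , eq , free | k , _ , eq′ , free′ with <-cmp j k
  ... | tri< j<k _ _ = contradiction ℓ∈L (LeakFree⇒∉ j<k (trans eq (sym eq′)) free′)
  ... | tri≈ _ refl _ = csuc-injective (⊕-cancelʳ j (trans eq (sym eq′)))
  ... | tri> _ _ k<j = contradiction ℓ′∈L (LeakFree⇒∉ k<j (trans eq′ (sym eq)) free)

  csuc-∈seg : ∀ {ℓ x} → ℓ ∈ L → x ∈ seg L (csuc ℓ) (suc m) →
              ∃ λ ℓ′ → ℓ′ ∈ L × csuc x ∈ seg L (csuc ℓ′) (suc m)
  csuc-∈seg {ℓ} {x} ℓ∈L x∈ with x ∈? L | ∈seg⁻ {csuc ℓ} (suc m) x∈
  ... | yes x∈L | _ = x , x∈L , ∈seg⁺ (suc m) (s≤s z≤n) (λ ())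
  ... | no x∉L | j , _ , refl , free =
    ℓ , ℓ∈L , ∈seg⁺ (suc m) (s≤s (LeakFree-length ℓ∈L free′)) free′
    where
    free′ : LeakFree (csuc ℓ) (suc j)
    free′ = LeakFree-snoc free x∉L

  ⊕-∈seg : ∀ {ℓ₀} → ℓ₀ ∈ L → ∀ k → ∃ λ ℓ → ℓ ∈ L × ℓ₀ ⊕ suc k ∈ seg L (csuc ℓ) (suc m)
  ⊕-∈seg ℓ₀∈L zero = _ , ℓ₀∈L , ∈seg⁺ (suc m) (s≤s z≤n) (λ ())
  ⊕-∈seg ℓ₀∈L (suc k) with ⊕-∈seg ℓ₀∈L k
  ... | ℓ , ℓ∈L , x∈ = csuc-∈seg ℓ∈L x∈

  seg-cover : Nonempty L → ∀ v → ∃ λ ℓ → ℓ ∈ L × v ∈ seg L (csuc ℓ) (suc m)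
  seg-cover (ℓ₀ , ℓ₀∈L) v with ⊕-surjective ℓ₀ v
  ... | k , refl = ⊕-∈seg ℓ₀∈L k

module _ {n : ℕ} where

  Empty⇒∣p∣≡0 : ∀ {p : Subset n} → Empty p → ∣ p ∣ ≡ 0
  Empty⇒∣p∣≡0 p-empty = trans (cong ∣_∣ (Empty-unique p-empty)) (∣⊥∣≡0 n)

  1≤∣p∣⇒Nonempty : ∀ {p : Subset n} → 1 ≤ ∣ p ∣ → Nonempty p
  1≤∣p∣⇒Nonempty {p} 1≤∣p∣ with nonempty? p
  ... | yes p-nonempty = p-nonempty
  ... | no p-empty = contradiction (Empty⇒∣p∣≡0 p-empty) (m<n⇒n≢0 1≤∣p∣)

  Nonempty⇒1≤∣p∣ : ∀ {p : Subset n} → Nonempty p → 1 ≤ ∣ p ∣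
  Nonempty⇒1≤∣p∣ (_ , x∈p) = ≤-trans (s≤s z≤n) (x∈p⇒∣p-x∣<∣p∣ x∈p)

  x∈p∧unique⇒∣p∣≡1 : ∀ {p : Subset n} {x} → x ∈ p → (∀ {y} → y ∈ p → y ≡ x) → ∣ p ∣ ≡ 1
  x∈p∧unique⇒∣p∣≡1 {p} {x} x∈p unique = trans (cong ∣_∣ (⊆-antisym p⊆⁅x⁆ ⁅x⁆⊆p)) (∣⁅x⁆∣≡1 x)
    where
    p⊆⁅x⁆ : p ⊆ ⁅ x ⁆
    p⊆⁅x⁆ y∈p = subst (_∈ ⁅ x ⁆) (sym (unique y∈p)) (x∈⁅x⁆ x)
    ⁅x⁆⊆p : ⁅ x ⁆ ⊆ p
    ⁅x⁆⊆p y∈⁅x⁆ = subst (_∈ p) (sym (x∈⁅y⁆⇒x≡y x y∈⁅x⁆)) x∈p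

  2≤∣p∣⇒∃≢ : ∀ {p : Subset n} {x} → 2 ≤ ∣ p ∣ → x ∈ p → ∃ λ y → y ∈ p × y ≢ x
  2≤∣p∣⇒∃≢ {p} {x} 2≤∣p∣ x∈p with any? (λ y → y ∈? p ×-dec ¬? (y ≟ x))
  ... | yes other = other
  ... | no none = contradiction (subst (∣ p ∣ ≤_) (∣⁅x⁆∣≡1 x) (p⊆q⇒∣p∣≤∣q∣ p⊆⁅x⁆)) (<⇒≱ 2≤∣p∣)
    where
    p⊆⁅x⁆ : p ⊆ ⁅ x ⁆
    p⊆⁅x⁆ {y} y∈p with y ≟ x
    ... | yes refl = x∈⁅x⁆ x
    ... | no y≢x = contradiction (y , y∈p , y≢x) none

module _ {n : ℕ} {P : Fin n → Set} (P? : ∀ x → Dec (P x)) where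

  ∈tabulate⁺ : ∀ {x} → P x → x ∈ tabulate (does ∘ P?)
  ∈tabulate⁺ {x} px = lookup⇒[]= x _ (trans (lookup∘tabulate (does ∘ P?) x) (dec-true (P? x) px))

  ∈tabulate⁻ : ∀ {x} → x ∈ tabulate (does ∘ P?) → P x
  ∈tabulate⁻ {x} x∈ with P? x | trans (sym (lookup∘tabulate (does ∘ P?) x)) ([]=⇒lookup x∈)
  ... | yes px | _ = px
  ... | no _ | ()

updateAt-pointwise : ∀ {n} {A : Set} {R : Fin n → A → Set} {xs : Vector A n} {i a} →
                     (∀ j → R j (xs j)) → R i a → ∀ j → R j (updateAt xs i (const a) j)
updateAt-pointwise {R = R} {xs} {i} all r j with j ≟ i
... | yes refl = subst (R j) (sym (updateAt-updates j xs)) r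
... | no j≢i = subst (R j) (sym (updateAt-minimal j i xs j≢i)) (all j)

module Selection {n : ℕ} (L : Subset n) (B : Fin n → Subset n)
  (B-disjoint : ∀ {ℓ ℓ′ v} → ℓ ∈ L → ℓ′ ∈ L → v ∈ B ℓ → v ∈ B ℓ′ → ℓ ≡ ℓ′)
  (pick : Fin n → Fin n × Bool) (pick∈B : ∀ {ℓ} → ℓ ∈ L → proj₁ (pick ℓ) ∈ B ℓ) where

  Picked : Bool → Fin n → Set
  Picked b v = ∃ λ ℓ → ℓ ∈ L × pick ℓ ≡ (v , b)

  picked? : ∀ b v → Dec (Picked b v)
  picked? b v = any? λ ℓ → ℓ ∈? L ×-dec Product.≡-dec _≟_ _≟ᵇ_ (pick ℓ) (v , b)

  selected : Bool → Subset n
  selected b = tabulate (does ∘ picked? b)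

  pick≡⇒∈B : ∀ {ℓ v b} → ℓ ∈ L → pick ℓ ≡ (v , b) → v ∈ B ℓ
  pick≡⇒∈B {ℓ} ℓ∈L eq = subst (_∈ B ℓ) (cong proj₁ eq) (pick∈B ℓ∈L)

  ∈selected⁺ : ∀ {ℓ v b} → ℓ ∈ L → pick ℓ ≡ (v , b) → v ∈ selected b
  ∈selected⁺ ℓ∈L eq = ∈tabulate⁺ (picked? _) (_ , ℓ∈L , eq)

  ∈selected⁻ : ∀ {v b} → v ∈ selected b → Picked b v
  ∈selected⁻ = ∈tabulate⁻ (picked? _)

  ∈B∩selected⇒pick≡ : ∀ {ℓ v b} → ℓ ∈ L → v ∈ B ℓ ∩ selected b → pick ℓ ≡ (v , b)
  ∈B∩selected⇒pick≡ {ℓ} ℓ∈L v∈ with x∈p∩q⁻ (B ℓ) _ v∈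
  ... | v∈Bℓ , v∈selected with ∈selected⁻ v∈selected
  ... | ℓ′ , ℓ′∈L , eq with B-disjoint ℓ∈L ℓ′∈L v∈Bℓ (pick≡⇒∈B ℓ′∈L eq)
  ... | refl = eq

  selected-disjoint : Empty (selected true ∩ selected false)
  selected-disjoint (v , v∈) with x∈p∩q⁻ (selected true) _ v∈
  ... | v∈true , v∈false with ∈selected⁻ v∈true
  ... | ℓ , ℓ∈L , eq with ∈B∩selected⇒pick≡ ℓ∈L (x∈p∩q⁺ (pick≡⇒∈B ℓ∈L eq , v∈false))
  ... | eq′ = contradiction (cong proj₂ (trans (sym eq) eq′)) λ ()

  ∣B∩selected∣≡1 : ∀ {ℓ} → ℓ ∈ L → ∣ B ℓ ∩ selected (proj₂ (pick ℓ)) ∣ ≡ 1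
  ∣B∩selected∣≡1 ℓ∈L = x∈p∧unique⇒∣p∣≡1 (x∈p∩q⁺ (pick∈B ℓ∈L , ∈selected⁺ ℓ∈L refl))
                         (λ y∈ → cong proj₁ (sym (∈B∩selected⇒pick≡ ℓ∈L y∈)))

  ∣B∩selected-not∣≡0 : ∀ {ℓ} → ℓ ∈ L → ∣ B ℓ ∩ selected (not (proj₂ (pick ℓ))) ∣ ≡ 0
  ∣B∩selected-not∣≡0 ℓ∈L =
    Empty⇒∣p∣≡0 λ (y , y∈) → not-¬ refl (cong proj₂ (∈B∩selected⇒pick≡ ℓ∈L y∈))

Ports : ∀ {n} → Model n → Bool → Subset n
Ports M true = In M
Ports M false = Out M

Interlaced : ∀ {n} → Model n → Set
Interlaced M = ∀ ℓ → ℓ ∈ Leak M → Nonempty (S M ℓ ∩ (In M ∪ Out M))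

Represents : ∀ {n} → Model n → Fin n → Fin n × Bool → Set
Represents M ℓ r = proj₁ r ∈ S M ℓ × proj₁ r ∈ Ports M (proj₂ r)

¬Exceptional-submodel : ∀ {n} {M : Model n} {In′ Out′ : Subset n} → In′ ⊆ In M → Out′ ⊆ Out M →
  ¬ Exceptional M → ¬ InExceptionalFamily M → ¬ Exceptional (model In′ Out′ (Leak M))
¬Exceptional-submodel {M = M} {In′} {Out′} In′⊆In Out′⊆Out ¬exc ¬family exc
  with Vec.≡-dec _≟ᵇ_ In′ (In M) | Vec.≡-dec _≟ᵇ_ Out′ (Out M)
... | yes refl | yes refl = ¬exc exc
... | no In′≢In | _ = ¬family (In′ , Out′ , exc , In′⊆In , Out′⊆Out , inj₁ In′≢In)
... | yes _ | no Out′≢Out = ¬family (In′ , Out′ , exc , In′⊆In , Out′⊆Out , inj₂ Out′≢Out)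

record Representatives {m : ℕ} (M : Model (suc m)) : Set where
  field
    pick : Fin (suc m) → Fin (suc m) × Bool
    represents : ∀ ℓ → ℓ ∈ Leak M → Represents M ℓ (pick ℓ)
    input-picked : ∃₂ λ ℓ v → ℓ ∈ Leak M × pick ℓ ≡ (v , true)
    output-picked : ∃₂ λ ℓ v → ℓ ∈ Leak M × pick ℓ ≡ (v , false)

module _ {m : ℕ} (M : Model (suc m)) where

  representative : ∀ {ℓ} → Nonempty (S M ℓ ∩ (In M ∪ Out M)) → ∃ (Represents M ℓ)
  representative {ℓ} (v , v∈) with x∈p∩q⁻ (S M ℓ) _ v∈
  ... | v∈S , v∈In∪Out with x∈p∪q⁻ (In M) (Out M) v∈In∪Out
  ... | inj₁ v∈In = (v , true) , v∈S , v∈In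
  ... | inj₂ v∈Out = (v , false) , v∈S , v∈Out

  representative-at : Interlaced M → ∀ ℓ → ∃ λ r → ℓ ∈ Leak M → Represents M ℓ r
  representative-at interlaced ℓ with ℓ ∈? Leak M
  ... | yes ℓ∈L = map₂ const (representative (interlaced ℓ ℓ∈L))
  ... | no ℓ∉L = (ℓ , true) , λ ℓ∈L → contradiction ℓ∈L ℓ∉L

  input-output-leaks : Interlaced M → 2 ≤ ∣ Leak M ∣ → Nonempty (In M) → Nonempty (Out M) →
    ∃₂ λ ℓᵢ ℓₒ → ℓᵢ ∈ Leak M × ℓₒ ∈ Leak M × ℓᵢ ≢ ℓₒ ×
      ∃ (λ vᵢ → Represents M ℓᵢ (vᵢ , true)) × ∃ (λ vₒ → Represents M ℓₒ (vₒ , false))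
  input-output-leaks interlaced 2≤∣L∣ (i , i∈In) (o , o∈Out) with 1≤∣p∣⇒Nonempty (<⇒≤ 2≤∣L∣)
  ... | some-leak with seg-cover (Leak M) some-leak i | seg-cover (Leak M) some-leak o
  ... | ℓᵢ , ℓᵢ∈L , i∈S | ℓₒ , ℓₒ∈L , o∈S with ℓᵢ ≟ ℓₒ
  ... | no ℓᵢ≢ℓₒ = ℓᵢ , ℓₒ , ℓᵢ∈L , ℓₒ∈L , ℓᵢ≢ℓₒ , (i , i∈S , i∈In) , (o , o∈S , o∈Out)
  ... | yes refl with 2≤∣p∣⇒∃≢ 2≤∣L∣ ℓᵢ∈L
  ...   | ℓ , ℓ∈L , ℓ≢ℓᵢ with representative (interlaced ℓ ℓ∈L)
  ...     | (v , true) , rep = ℓ , ℓᵢ , ℓ∈L , ℓᵢ∈L , ℓ≢ℓᵢ , (v , rep) , (o , o∈S , o∈Out)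
  ...     | (v , false) , rep = ℓᵢ , ℓ , ℓᵢ∈L , ℓ∈L , ℓ≢ℓᵢ ∘ sym , (i , i∈S , i∈In) , (v , rep)

  representatives : Interlaced M → 2 ≤ ∣ Leak M ∣ → Nonempty (In M) → Nonempty (Out M) →
                    Representatives M
  representatives interlaced 2≤∣L∣ has-input has-output
    with input-output-leaks interlaced 2≤∣L∣ has-input has-output
  ... | ℓᵢ , ℓₒ , ℓᵢ∈L , ℓₒ∈L , ℓᵢ≢ℓₒ , (vᵢ , repᵢ) , (vₒ , repₒ) = record
    { pick = pick
    ; represents = updateAt-pointwise {R = Admissible}
                     (updateAt-pointwise {R = Admissible} default-admissible (const repᵢ))
                     (const repₒ)
    ; input-picked = ℓᵢ , vᵢ , ℓᵢ∈L ,
                     trans (updateAt-minimal ℓᵢ ℓₒ _ ℓᵢ≢ℓₒ) (updateAt-updates ℓᵢ default)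
    ; output-picked = ℓₒ , vₒ , ℓₒ∈L , updateAt-updates ℓₒ _
    }
    where
    Admissible : Fin (suc m) → Fin (suc m) × Bool → Set
    Admissible ℓ r = ℓ ∈ Leak M → Represents M ℓ r
    default : Fin (suc m) → Fin (suc m) × Bool
    default = proj₁ ∘ representative-at interlaced
    default-admissible : ∀ ℓ → Admissible ℓ (default ℓ)
    default-admissible = proj₂ ∘ representative-at interlaced
    pick : Fin (suc m) → Fin (suc m) × Bool
    pick = updateAt (updateAt default ℓᵢ (const (vᵢ , true))) ℓₒ (const (vₒ , false))

module Submodel {m : ℕ} {M : Model (suc m)} (R : Representatives M) where
  open Representatives R public

  pick∈S : ∀ {ℓ} → ℓ ∈ Leak M → proj₁ (pick ℓ) ∈ S M ℓ
  pick∈S ℓ∈L = proj₁ (represents _ ℓ∈L)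

  S-disjoint : ∀ {ℓ ℓ′ v} → ℓ ∈ Leak M → ℓ′ ∈ Leak M → v ∈ S M ℓ → v ∈ S M ℓ′ → ℓ ≡ ℓ′
  S-disjoint = seg-disjoint (Leak M) {f = suc m} {f′ = suc m}

  open Selection (Leak M) (S M) S-disjoint pick pick∈S public

  submodel : Model (suc m)
  submodel = model (selected true) (selected false) (Leak M)

  selected⊆Ports : ∀ b → selected b ⊆ Ports M b
  selected⊆Ports b v∈ with ∈selected⁻ v∈
  ... | ℓ , ℓ∈L , eq = subst (λ r → proj₁ r ∈ Ports M (proj₂ r)) eq (proj₂ (represents ℓ ℓ∈L))

  1≤∣selected∣ : ∀ {b} → (∃₂ λ ℓ v → ℓ ∈ Leak M × pick ℓ ≡ (v , b)) → 1 ≤ ∣ selected b ∣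
  1≤∣selected∣ (ℓ , v , ℓ∈L , eq) = Nonempty⇒1≤∣p∣ (v , ∈selected⁺ ℓ∈L eq)

  submodel-interlaced : Interlaced submodel
  submodel-interlaced ℓ ℓ∈L =
    proj₁ (pick ℓ) , x∈p∩q⁺ (pick∈S ℓ∈L , selected⊆∪ (proj₂ (pick ℓ)) (∈selected⁺ ℓ∈L refl))
    where
    selected⊆∪ : ∀ b → selected b ⊆ selected true ∪ selected false
    selected⊆∪ true = p⊆p∪q (selected false)
    selected⊆∪ false = q⊆p∪q (selected true) (selected false)

  one-port-per-segment : ∀ ℓ → ℓ ∈ Leak M →
    ((∣ S M ℓ ∩ selected true ∣ ≡ 1) × (∣ S M ℓ ∩ selected false ∣ ≡ 0)) ⊎
    ((∣ S M ℓ ∩ selected true ∣ ≡ 0) × (∣ S M ℓ ∩ selected false ∣ ≡ 1))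
  one-port-per-segment ℓ ℓ∈L
    with proj₂ (pick ℓ) | ∣B∩selected∣≡1 ℓ∈L | ∣B∩selected-not∣≡0 ℓ∈L
  ... | true | one | none = inj₁ (one , none)
  ... | false | one | none = inj₂ (none , one)

lemma3p23 : (n : ℕ) → 3 ≤ n → (M : Model n) →
    LeakInterlacing M → 1 ≤ ∣ In M ∣ → 1 ≤ ∣ Out M ∣ → 2 ≤ ∣ Leak M ∣ →
    ¬ InExceptionalFamily M →
    ∃ λ (In′ : Subset n) → ∃ λ (Out′ : Subset n) →
      (In′ ⊆ In M) × (Out′ ⊆ Out M) × (1 ≤ ∣ In′ ∣) × (1 ≤ ∣ Out′ ∣) ×
      Empty (In′ ∩ Out′) × MinimallyLeakInterlacing (model In′ Out′ (Leak M))
lemma3p23 zero ()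
lemma3p23 (suc m) _ M (_ , inj₁ ∣L∣≤1) _ _ 2≤∣L∣ _ = contradiction ∣L∣≤1 (<⇒≱ 2≤∣L∣)
lemma3p23 (suc m) _ M (¬exc , inj₂ (_ , interlaced)) 1≤∣In∣ 1≤∣Out∣ 2≤∣L∣ ¬family =
  selected true , selected false , selected⊆Ports true , selected⊆Ports false ,
  1≤∣selected∣ input-picked , 1≤∣selected∣ output-picked , selected-disjoint ,
  2≤∣L∣ , (¬exceptional , inj₂ (2≤∣L∣ , submodel-interlaced)) , one-port-per-segment
  where
  open Submodel
    (representatives M interlaced 2≤∣L∣ (1≤∣p∣⇒Nonempty 1≤∣In∣) (1≤∣p∣⇒Nonempty 1≤∣Out∣))
  ¬exceptional : ¬ Exceptional submodel
  ¬exceptional = ¬Exceptional-submodel (selected⊆Ports true) (selected⊆Ports false) ¬exc ¬family
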